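{- Let $h\in\mathbb{N}$, $x\ge0$ an integer, and $\theta\in\mathcal{U}$. Then there are at most $q$ distinct pairs $(G,H)$ of polynomials in $\mathbb{F}_q[T]$ such that $H$ is monic squarefree of degree $h$ with $H\notin\{1,T\}$, $G$ is coprime to $H$ with $\deg G<h$, and $|\{T^xG/H-\theta\}|<q^{ -2h}$. Moreover, if $x=0$ there is at most one such pair.
   Context: $\mathbb{F}_q(T)_\infty=\{\sum_{l<k}a_lT^l\}$ is the completion of $\mathbb{F}_q(T)$ at $1/T$, and $\mathcal{U}=\{\sum_{l<0}a_lT^l\}$. For $\beta=\sum_{l<k}\beta_lT^l$, $\{\beta\}=\sum_{l<0}\beta_lT^l$; the absolute value is $|\beta|=q^{k-1}$ if $\beta_{k-1}\neq0$ is the leading coefficient, and $|0|=0$. -}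

module Defs where

open import Level using (0ℓ)
open import Data.Nat as ℕ using (ℕ; zero; suc; _<_)
open import Data.Fin using (Fin)
open import Data.List using (List; []; _∷_; map; length; _++_; [_])
open import Data.Vec using (Vec; toList)
open import Data.Product using (Σ; ∃; _×_; _,_)
open import Relation.Nullary using (¬_)
open import Relation.Binary.PropositionalEquality using (_≡_; _≢_)
open import Algebra.Structures using (IsCommutativeRing)
open import Function.Bundles using (_↔_)

record FiniteField (q : ℕ) : Set₁ where
  infixl 6 _+_
  infixl 7 _*_
  field
    Carrier : Set
    _+_ _*_ : Carrier → Carrier → Carrier
    -_ : Carrier → Carrier
    0# 1# : Carrier
    isCommutativeRing : IsCommutativeRing _≡_ _+_ _*_ -_ 0# 1#
    0≢1 : 0# ≢ 1#
    inverse : ∀ x → x ≢ 0# → ∃ λ y → x * y ≡ 1#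
    enumeration : Carrier ↔ Fin q

module FqT {q : ℕ} (F : FiniteField q) where
  open FiniteField F

  -- Polynomials in F_q[T]: coefficient lists, lowest degree first
  -- (trailing zeros allowed; equality is coefficientwise).
  Poly : Set
  Poly = List Carrier

  coeff : Poly → ℕ → Carrier
  coeff []      _       = 0#
  coeff (a ∷ p) zero    = a
  coeff (a ∷ p) (suc n) = coeff p n

  _≈ₚ_ : Poly → Poly → Set
  p ≈ₚ r = ∀ n → coeff p n ≡ coeff r n

  _⊕_ : Poly → Poly → Poly
  []      ⊕ r       = r
  (a ∷ p) ⊕ []      = a ∷ p
  (a ∷ p) ⊕ (b ∷ r) = (a + b) ∷ (p ⊕ r)

  _⊛_ : Poly → Poly → Poly
  []      ⊛ r = []
  (a ∷ p) ⊛ r = map (a *_) r ⊕ (0# ∷ (p ⊛ r))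

  _∣ₚ_ : Poly → Poly → Set
  d ∣ₚ p = ∃ λ s → (d ⊛ s) ≈ₚ p

  IsConstant : Poly → Set
  IsConstant p = ∀ n → coeff p (suc n) ≡ 0#

  Squarefree : Poly → Set
  Squarefree p = ∀ d → (d ⊛ d) ∣ₚ p → IsConstant d

  Coprime : Poly → Poly → Set
  Coprime g h = ∀ d → d ∣ₚ g → d ∣ₚ h → IsConstant d

  monic : ∀ {h} → Vec Carrier h → Poly
  monic a = toList a ++ [ 1# ]

  -- Elements of U = { Σ_{l<0} a_l T^l }: s k is the coefficient of T^{-(k+1)}.
  U : Set
  U = ℕ → Carrier

  sumTo : ℕ → (ℕ → Carrier) → Carrier
  sumTo zero    f = 0#
  sumTo (suc n) f = sumTo n f + f n

  -- Coefficient of T^n (n ≥ 0) in the product H·s  (H polynomial, s ∈ U)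
  prodCoeffPos : Poly → U → ℕ → Carrier
  prodCoeffPos H s n = sumTo (length H) (λ i → coeff H (suc (i ℕ.+ n)) * s i)

  -- Coefficient of T^{-(n+1)} in the product H·s
  prodCoeffNeg : Poly → U → ℕ → Carrier
  prodCoeffNeg H s n = sumTo (length H) (λ i → coeff H i * s (i ℕ.+ n))

  -- s is the Laurent expansion of G/H in F_q(T)_∞, i.e. H·s = G
  IsExpansion : Poly → Poly → U → Set
  IsExpansion H G s = (∀ n → prodCoeffPos H s n ≡ coeff G n)
                    × (∀ n → prodCoeffNeg H s n ≡ 0#)

  -- The pair (G,H), G = Σ_{i<h} g_i T^i (deg G < h), H = monic a of degree h,
  -- satisfies the hypotheses of the lemma for x and θ:
  -- |{T^x G/H - θ}| < q^{-2h}, i.e. the coefficients of T^{-1},…,T^{-2h}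
  -- of T^x G/H and θ agree (the coefficient of T^{-(j+1)} in T^x G/H
  -- is the coefficient of T^{-(j+x+1)} in G/H).
  GoodPair : (h x : ℕ) → U → Vec Carrier h × Vec Carrier h → Set
  GoodPair h x θ (g , a) =
    Squarefree H
    × ¬ (H ≈ₚ [ 1# ])
    × ¬ (H ≈ₚ (0# ∷ 1# ∷ []))
    × Coprime G H
    × (∃ λ s → IsExpansion H G s × (∀ j → j < 2 ℕ.* h → s (j ℕ.+ x) ≡ θ j))
    where
      H = monic a
      G = toList g

module Submission where

open import Defs
open import Data.Nat using (ℕ; _≤_)
open import Data.List using (List; length)
open import Data.List.Relation.Unary.All using (All)
open import Data.List.Relation.Unary.Unique.Propositional using (Unique)
open import Data.Vec using (Vec)
open import Data.Product using (_×_)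
open import Relation.Binary.PropositionalEquality using (_≡_)

import Data.Nat as ℕ
open import Data.Nat using (zero; suc; _<_; z≤n; s≤s; _≤?_; _<?_)
import Data.Nat.Properties as ℕP
open import Data.List using ([]; _∷_; map; [_]; drop; lookup)
import Data.List.Properties as ListP
open import Data.List.Relation.Unary.All using ([]; _∷_; reduce)
open import Data.List.Relation.Unary.AllPairs using ([]; _∷_)
open import Data.Vec using (toList) renaming ([] to []ᵥ; _∷_ to _∷ᵥ_)
open import Data.Product using (∃; _,_; proj₁; proj₂)
open import Data.Sum using (_⊎_; inj₁; inj₂)
open import Data.Empty using (⊥-elim)
open import Data.Unit using (⊤; tt)
open import Relation.Nullary using (¬_; Dec; yes; no)
open import Relation.Binary using (tri<; tri≈; tri>)
open import Relation.Binary.PropositionalEquality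
  using (_≢_; refl; sym; trans; cong; cong₂; subst; module ≡-Reasoning)
open import Relation.Binary.Bundles using (Setoid)
import Relation.Binary.Reasoning.Setoid as SetoidReasoning
open import Algebra.Bundles using (CommutativeRing)
open import Algebra.Structures using (IsCommutativeRing)
open import Function.Bundles using (Inverse; Injection)
open import Function.Properties.Inverse using (↔⇒↣)
import Data.Fin as Fin
import Data.Fin.Properties as FinP


-- Write G/H = Σ_k s_k T^(-(k+1)) and t = {T^x·G/H}, the tail of s from x on.
-- If (G₁,H₁) and (G₂,H₂) are good, t₁ and t₂ agree with θ in 2h
-- coefficients; both are annihilated by the monic H₁H₂ of degree 2h (a
-- linear recurrence of order 2h), so t₁ = t₂.  Then T^x·Gᵢ = Hᵢ·Sᵢ + Hᵢ·t
-- with polynomials Sᵢ, and coprimality (Gauss' lemma) gives H₁ ∣ T^x·H₂ and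
-- H₂ ∣ T^x·H₁; since T² divides neither, H₁ = H₂.  Finally
-- T^x·(G₁ − G₂) = H·(S₁ − S₂) with deg(G₁ − G₂) < h forces G₁ = G₂, except
-- when T ∣ H, where one more datum is needed: x = 0, or equal first
-- coefficients s₀ of the two expansions.  Hence s₀ ∈ F_q determines the
-- pair, and pigeonhole gives the bounds q and 1.

lookup-distinct : ∀ {A : Set} (zs : List A) → Unique zs →
                  ∀ i j → i Fin.< j → lookup zs i ≢ lookup zs j
lookup-distinct (z ∷ zs) (z∉zs ∷ _) Fin.zero (Fin.suc j) _ = entry z∉zs j
  where
    entry : ∀ {ys} → All (z ≢_) ys → ∀ j → z ≢ lookup ys j
    entry (z≢y ∷ _)  Fin.zero    = z≢y
    entry (_ ∷ rest) (Fin.suc j) = entry rest j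
lookup-distinct (z ∷ zs) (_ ∷ u) (Fin.suc i) (Fin.suc j) (s≤s i<j) = lookup-distinct zs u i j i<j

unique-length-bound : ∀ {A : Set} {n} (ι : A → Fin.Fin n) → (∀ {x y} → ι x ≡ ι y → x ≡ y) →
                      (zs : List A) → Unique zs → length zs ≤ n
unique-length-bound {n = n} ι ι-injective zs u with length zs ≤? n
... | yes le = le
... | no  gt with FinP.pigeonhole (ℕP.≰⇒> gt) (λ i → ι (lookup zs i))
...   | i , j , i<j , same = ⊥-elim (lookup-distinct zs u i j i<j (ι-injective same))

reduce-length : ∀ {A B : Set} {P : A → Set} (f : ∀ {x} → P x → B) {xs} (pxs : All P xs) →
                length (reduce f pxs) ≡ length xs
reduce-length f []         = refl
reduce-length f (px ∷ pxs) = cong suc (reduce-length f pxs)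

reduce-unique : ∀ {A B : Set} {P : A → Set} (f : ∀ {x} → P x → B) →
                (∀ {x y} (px : P x) (py : P y) → f px ≡ f py → x ≡ y) →
                ∀ {xs} (pxs : All P xs) → Unique xs → Unique (reduce f pxs)
reduce-unique f determines []         []         = []
reduce-unique {P = P} f determines {x ∷ _} (px ∷ pxs) (x∉ ∷ u) =
  fresh x∉ pxs ∷ reduce-unique f determines pxs u
  where
    fresh : ∀ {ys} → All (x ≢_) ys → (pys : All P ys) → All (f px ≢_) (reduce f pys)
    fresh []           []         = []
    fresh (x≢y ∷ rest) (py ∷ pys) = (λ e → x≢y (determines px py e)) ∷ fresh rest pys

module Theory {q : ℕ} (F : FiniteField q) where
  open FiniteField F
  open FqT F
  open IsCommutativeRing isCommutativeRing
    using (+-comm; +-assoc; *-comm; *-assoc; distribˡ; distribʳ; zeroˡ; zeroʳ;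
           +-identityˡ; +-identityʳ; *-identityˡ; *-identityʳ; -‿inverseˡ)

  Fq : CommutativeRing _ _
  Fq = record { isCommutativeRing = isCommutativeRing }

  open import Algebra.Properties.Ring (CommutativeRing.ring Fq) using (-1*x≈-x)
  open import Algebra.Properties.CommutativeSemigroup
    (CommutativeRing.+-commutativeSemigroup Fq) using (interchange)

  -- Field arithmetic.  Subtraction is written x + (- 1#) * y throughout,
  -- so that negating a polynomial is scaling it by - 1#.

  minus-cancelˡ : ∀ x → (- 1#) * x + x ≡ 0#
  minus-cancelˡ x = trans (cong (_+ x) (-1*x≈-x x)) (-‿inverseˡ x)

  minus-cancelʳ : ∀ x → x + (- 1#) * x ≡ 0#
  minus-cancelʳ x = trans (+-comm _ _) (minus-cancelˡ x)

  difference-zero : ∀ x y → x + (- 1#) * y ≡ 0# → x ≡ y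
  difference-zero x y e = begin
    x                             ≡⟨ sym (+-identityʳ x) ⟩
    x + 0#                        ≡⟨ cong (x +_) (sym (minus-cancelˡ y)) ⟩
    x + ((- 1#) * y + y)          ≡⟨ sym (+-assoc _ _ _) ⟩
    (x + (- 1#) * y) + y          ≡⟨ cong (_+ y) e ⟩
    0# + y                        ≡⟨ +-identityˡ y ⟩
    y                             ∎
    where open ≡-Reasoning

  1≢0 : 1# ≢ 0#
  1≢0 e = 0≢1 (sym e)

  index : Carrier → Fin.Fin q
  index = Inverse.to enumeration

  index-injective : ∀ {x y} → index x ≡ index y → x ≡ y
  index-injective = Injection.injective (↔⇒↣ enumeration)

  _≟_ : (x y : Carrier) → Dec (x ≡ y)
  x ≟ y with index x Fin.≟ index y
  ... | yes e = yes (index-injective e)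
  ... | no ne = no (λ e → ne (cong index e))

  inv : ∀ x → x ≢ 0# → Carrier
  inv x nz = proj₁ (inverse x nz)

  inv-correct : ∀ x (nz : x ≢ 0#) → x * inv x nz ≡ 1#
  inv-correct x nz = proj₂ (inverse x nz)

  no-zero-divisors : ∀ a b → a ≢ 0# → a * b ≡ 0# → b ≡ 0#
  no-zero-divisors a b nz ab = begin
    b                  ≡⟨ sym (*-identityˡ b) ⟩
    1# * b             ≡⟨ cong (_* b) (sym (trans (*-comm _ _) (inv-correct a nz))) ⟩
    (inv a nz * a) * b ≡⟨ *-assoc _ _ _ ⟩
    inv a nz * (a * b) ≡⟨ cong (inv a nz *_) ab ⟩
    inv a nz * 0#      ≡⟨ zeroʳ _ ⟩
    0#                 ∎
    where open ≡-Reasoning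

  -- Polynomials up to coefficientwise equality.  The record wrapper lets
  -- Agda infer both sides of an equation from its proof.
  infix 4 _≈_
  record _≈_ (p r : Poly) : Set where
    constructor coeffwise
    field at : ∀ n → coeff p n ≡ coeff r n
  open _≈_

  ≈-refl : ∀ {p} → p ≈ p
  ≈-refl = coeffwise λ _ → refl

  ≈-sym : ∀ {p r} → p ≈ r → r ≈ p
  ≈-sym e = coeffwise λ n → sym (at e n)

  ≈-trans : ∀ {p r u} → p ≈ r → r ≈ u → p ≈ u
  ≈-trans e f = coeffwise λ n → trans (at e n) (at f n)

  PolySetoid : Setoid _ _
  PolySetoid = record
    { Carrier = Poly ; _≈_ = _≈_
    ; isEquivalence = record { refl = ≈-refl ; sym = ≈-sym ; trans = ≈-trans } }

  module ≈-Reasoning = SetoidReasoning PolySetoid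

  scale : Carrier → Poly → Poly
  scale c p = map (c *_) p

  negate : Poly → Poly
  negate p = scale (- 1#) p

  shift : ℕ → Poly → Poly
  shift zero    p = p
  shift (suc n) p = 0# ∷ shift n p

  tailP : Poly → Poly
  tailP []      = []
  tailP (a ∷ p) = p

  one : Poly
  one = [ 1# ]

  Tpoly : Poly
  Tpoly = 0# ∷ one

  coeff-tail : ∀ p n → coeff (tailP p) n ≡ coeff p (suc n)
  coeff-tail []      n = refl
  coeff-tail (a ∷ p) n = refl

  coeff-⊕ : ∀ p r n → coeff (p ⊕ r) n ≡ coeff p n + coeff r n
  coeff-⊕ []      r       n       = sym (+-identityˡ _)
  coeff-⊕ (a ∷ p) []      n       = sym (+-identityʳ _)
  coeff-⊕ (a ∷ p) (b ∷ r) zero    = refl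
  coeff-⊕ (a ∷ p) (b ∷ r) (suc n) = coeff-⊕ p r n

  coeff-scale : ∀ c p n → coeff (scale c p) n ≡ c * coeff p n
  coeff-scale c []      n       = sym (zeroʳ c)
  coeff-scale c (a ∷ p) zero    = refl
  coeff-scale c (a ∷ p) (suc n) = coeff-scale c p n

  coeff-negate : ∀ p n → coeff (negate p) n ≡ (- 1#) * coeff p n
  coeff-negate = coeff-scale (- 1#)

  tail-cong : ∀ {p r} → p ≈ r → tailP p ≈ tailP r
  tail-cong {p} {r} e = coeffwise λ n →
    trans (coeff-tail p n) (trans (at e (suc n)) (sym (coeff-tail r n)))

  ∷-cong : ∀ {a b p r} → a ≡ b → p ≈ r → (a ∷ p) ≈ (b ∷ r)
  ∷-cong e f = coeffwise λ { zero → e ; (suc n) → at f n }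

  ⊕-cong : ∀ {p p' r r'} → p ≈ p' → r ≈ r' → (p ⊕ r) ≈ (p' ⊕ r')
  ⊕-cong {p} {p'} {r} {r'} e f = coeffwise λ n →
    trans (coeff-⊕ p r n) (trans (cong₂ _+_ (at e n) (at f n)) (sym (coeff-⊕ p' r' n)))

  scale-cong : ∀ {c d p r} → c ≡ d → p ≈ r → scale c p ≈ scale d r
  scale-cong {c} {d} {p} {r} e f = coeffwise λ n →
    trans (coeff-scale c p n) (trans (cong₂ _*_ e (at f n)) (sym (coeff-scale d r n)))

  shift-cong : ∀ d {p r} → p ≈ r → shift d p ≈ shift d r
  shift-cong zero    e = e
  shift-cong (suc d) e = ∷-cong refl (shift-cong d e)

  []≈0 : [] ≈ [ 0# ]
  []≈0 = coeffwise λ { zero → refl ; (suc n) → refl }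

  0∷-zero : ∀ {p} → p ≈ [] → (0# ∷ p) ≈ []
  0∷-zero e = coeffwise λ { zero → refl ; (suc n) → at e n }

  ≈0∷tail : ∀ p → coeff p 0 ≡ 0# → p ≈ (0# ∷ tailP p)
  ≈0∷tail p e = coeffwise λ { zero → e ; (suc n) → sym (coeff-tail p n) }

  ⊕-comm : ∀ p r → (p ⊕ r) ≈ (r ⊕ p)
  ⊕-comm p r = coeffwise λ n →
    trans (coeff-⊕ p r n) (trans (+-comm _ _) (sym (coeff-⊕ r p n)))

  ⊕-assoc : ∀ p r u → ((p ⊕ r) ⊕ u) ≈ (p ⊕ (r ⊕ u))
  ⊕-assoc p r u = coeffwise λ n → begin
    coeff ((p ⊕ r) ⊕ u) n                ≡⟨ coeff-⊕ (p ⊕ r) u n ⟩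
    coeff (p ⊕ r) n + coeff u n          ≡⟨ cong (_+ coeff u n) (coeff-⊕ p r n) ⟩
    (coeff p n + coeff r n) + coeff u n  ≡⟨ +-assoc _ _ _ ⟩
    coeff p n + (coeff r n + coeff u n)  ≡⟨ cong (coeff p n +_) (sym (coeff-⊕ r u n)) ⟩
    coeff p n + coeff (r ⊕ u) n          ≡⟨ sym (coeff-⊕ p (r ⊕ u) n) ⟩
    coeff (p ⊕ (r ⊕ u)) n                ∎
    where open ≡-Reasoning

  ⊕-interchange : ∀ p r u v → ((p ⊕ r) ⊕ (u ⊕ v)) ≈ ((p ⊕ u) ⊕ (r ⊕ v))
  ⊕-interchange p r u v = coeffwise λ n →
    trans (coeff-⊕ (p ⊕ r) (u ⊕ v) n)
      (trans (cong₂ _+_ (coeff-⊕ p r n) (coeff-⊕ u v n))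
        (trans (interchange _ _ _ _)
          (sym (trans (coeff-⊕ (p ⊕ u) (r ⊕ v) n) (cong₂ _+_ (coeff-⊕ p u n) (coeff-⊕ r v n))))))

  ⊕-identityʳ : ∀ p → (p ⊕ []) ≈ p
  ⊕-identityʳ p = coeffwise λ n → trans (coeff-⊕ p [] n) (+-identityʳ _)

  negate-inverseˡ : ∀ p → (negate p ⊕ p) ≈ []
  negate-inverseˡ p = coeffwise λ n →
    trans (coeff-⊕ (negate p) p n)
      (trans (cong (_+ coeff p n) (coeff-negate p n)) (minus-cancelˡ _))

  0∷-⊕ : ∀ p r → ((0# ∷ p) ⊕ (0# ∷ r)) ≈ (0# ∷ (p ⊕ r))
  0∷-⊕ p r = ∷-cong (+-identityˡ 0#) ≈-refl

  scale-⊕ : ∀ c p r → scale c (p ⊕ r) ≈ (scale c p ⊕ scale c r)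
  scale-⊕ c p r = coeffwise λ n →
    trans (coeff-scale c (p ⊕ r) n)
      (trans (cong (c *_) (coeff-⊕ p r n))
        (trans (distribˡ _ _ _)
          (sym (trans (coeff-⊕ (scale c p) (scale c r) n)
                      (cong₂ _+_ (coeff-scale c p n) (coeff-scale c r n))))))

  scale-scale : ∀ c d p → scale c (scale d p) ≈ scale (c * d) p
  scale-scale c d p = coeffwise λ n →
    trans (coeff-scale c (scale d p) n)
      (trans (cong (c *_) (coeff-scale d p n))
        (trans (sym (*-assoc _ _ _)) (sym (coeff-scale (c * d) p n))))

  scale-1 : ∀ p → scale 1# p ≈ p
  scale-1 p = coeffwise λ n → trans (coeff-scale 1# p n) (*-identityˡ _)

  scale-0 : ∀ p → scale 0# p ≈ []
  scale-0 p = coeffwise λ n → trans (coeff-scale 0# p n) (zeroˡ _)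

  scale-0∷ : ∀ c p → scale c (0# ∷ p) ≈ (0# ∷ scale c p)
  scale-0∷ c p = ∷-cong (zeroʳ c) ≈-refl

  coeff-⊛-∷ : ∀ a p r n → coeff ((a ∷ p) ⊛ r) n ≡ a * coeff r n + coeff (0# ∷ (p ⊛ r)) n
  coeff-⊛-∷ a p r n = trans (coeff-⊕ (scale a r) _ n) (cong (_+ _) (coeff-scale a r n))

  coeff0-⊛ : ∀ p r → coeff (p ⊛ r) 0 ≡ coeff p 0 * coeff r 0
  coeff0-⊛ []      r = sym (zeroˡ _)
  coeff0-⊛ (a ∷ p) r = trans (coeff-⊛-∷ a p r 0) (+-identityʳ _)

  ⊛-nilʳ : ∀ p → (p ⊛ []) ≈ []
  ⊛-nilʳ []      = ≈-refl
  ⊛-nilʳ (a ∷ p) = 0∷-zero (⊛-nilʳ p)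

  ⊛-congʳ : ∀ p {r r'} → r ≈ r' → (p ⊛ r) ≈ (p ⊛ r')
  ⊛-congʳ []      e = ≈-refl
  ⊛-congʳ (a ∷ p) e = ⊕-cong (scale-cong refl e) (∷-cong refl (⊛-congʳ p e))

  0∷-⊛ : ∀ p r → ((0# ∷ p) ⊛ r) ≈ (0# ∷ (p ⊛ r))
  0∷-⊛ p r = coeffwise λ n →
    trans (coeff-⊕ (scale 0# r) (0# ∷ (p ⊛ r)) n)
      (trans (cong (_+ coeff (0# ∷ (p ⊛ r)) n) (at (scale-0 r) n)) (+-identityˡ _))

  ⊛-∷ʳ : ∀ p c r → (p ⊛ (c ∷ r)) ≈ (scale c p ⊕ (0# ∷ (p ⊛ r)))
  ⊛-∷ʳ []      c r = []≈0
  ⊛-∷ʳ (a ∷ p) c r = begin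
      scale a (c ∷ r) ⊕ (0# ∷ (p ⊛ (c ∷ r)))
    ≈⟨ ⊕-cong (≈-refl {scale a (c ∷ r)}) (∷-cong refl (⊛-∷ʳ p c r)) ⟩
      (a * c + 0#) ∷ (scale a r ⊕ (scale c p ⊕ (0# ∷ (p ⊛ r))))
    ≈⟨ ∷-cong (cong (_+ 0#) (*-comm a c)) swap ⟩
      (c * a + 0#) ∷ (scale c p ⊕ (scale a r ⊕ (0# ∷ (p ⊛ r))))
    ∎
    where
      open ≈-Reasoning
      swap : (scale a r ⊕ (scale c p ⊕ (0# ∷ (p ⊛ r))))
           ≈ (scale c p ⊕ (scale a r ⊕ (0# ∷ (p ⊛ r))))
      swap = ≈-trans (≈-sym (⊕-assoc (scale a r) (scale c p) _))
               (≈-trans (⊕-cong (⊕-comm (scale a r) (scale c p)) ≈-refl)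
                        (⊕-assoc (scale c p) (scale a r) _))

  ⊛-comm : ∀ p r → (p ⊛ r) ≈ (r ⊛ p)
  ⊛-comm []      r = ≈-sym (⊛-nilʳ r)
  ⊛-comm (a ∷ p) r =
    ≈-trans (⊕-cong (≈-refl {scale a r}) (∷-cong refl (⊛-comm p r))) (≈-sym (⊛-∷ʳ r a p))

  ⊛-congˡ : ∀ {p p'} r → p ≈ p' → (p ⊛ r) ≈ (p' ⊛ r)
  ⊛-congˡ {p} {p'} r e = ≈-trans (⊛-comm p r) (≈-trans (⊛-congʳ r e) (⊛-comm r p'))

  ⊛-zeroˡ : ∀ {p} r → p ≈ [] → (p ⊛ r) ≈ []
  ⊛-zeroˡ = ⊛-congˡ

  ⊛-distribˡ : ∀ p r u → (p ⊛ (r ⊕ u)) ≈ ((p ⊛ r) ⊕ (p ⊛ u))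
  ⊛-distribˡ []      r u = ≈-refl
  ⊛-distribˡ (a ∷ p) r u = begin
      scale a (r ⊕ u) ⊕ (0# ∷ (p ⊛ (r ⊕ u)))
    ≈⟨ ⊕-cong (scale-⊕ a r u)
              (≈-trans (∷-cong refl (⊛-distribˡ p r u)) (≈-sym (0∷-⊕ (p ⊛ r) (p ⊛ u)))) ⟩
      (scale a r ⊕ scale a u) ⊕ ((0# ∷ (p ⊛ r)) ⊕ (0# ∷ (p ⊛ u)))
    ≈⟨ ⊕-interchange (scale a r) (scale a u) (0# ∷ (p ⊛ r)) (0# ∷ (p ⊛ u)) ⟩
      (scale a r ⊕ (0# ∷ (p ⊛ r))) ⊕ (scale a u ⊕ (0# ∷ (p ⊛ u)))
    ∎
    where open ≈-Reasoning

  ⊛-distribʳ : ∀ p r u → ((p ⊕ r) ⊛ u) ≈ ((p ⊛ u) ⊕ (r ⊛ u))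
  ⊛-distribʳ p r u =
    ≈-trans (⊛-comm (p ⊕ r) u) (≈-trans (⊛-distribˡ u p r) (⊕-cong (⊛-comm u p) (⊛-comm u r)))

  scale-⊛ : ∀ c p r → (scale c p ⊛ r) ≈ scale c (p ⊛ r)
  scale-⊛ c []      r = ≈-refl
  scale-⊛ c (a ∷ p) r = begin
      scale (c * a) r ⊕ (0# ∷ (scale c p ⊛ r))
    ≈⟨ ⊕-cong (≈-sym (scale-scale c a r))
              (≈-trans (∷-cong refl (scale-⊛ c p r)) (≈-sym (scale-0∷ c (p ⊛ r)))) ⟩
      scale c (scale a r) ⊕ scale c (0# ∷ (p ⊛ r))
    ≈⟨ ≈-sym (scale-⊕ c (scale a r) (0# ∷ (p ⊛ r))) ⟩
      scale c (scale a r ⊕ (0# ∷ (p ⊛ r)))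
    ∎
    where open ≈-Reasoning

  ⊛-scale : ∀ c p r → (p ⊛ scale c r) ≈ scale c (p ⊛ r)
  ⊛-scale c p r =
    ≈-trans (⊛-comm p (scale c r)) (≈-trans (scale-⊛ c r p) (scale-cong refl (⊛-comm r p)))

  ⊛-assoc : ∀ p r u → ((p ⊛ r) ⊛ u) ≈ (p ⊛ (r ⊛ u))
  ⊛-assoc []      r u = ≈-refl
  ⊛-assoc (a ∷ p) r u = begin
      (scale a r ⊕ (0# ∷ (p ⊛ r))) ⊛ u
    ≈⟨ ⊛-distribʳ (scale a r) (0# ∷ (p ⊛ r)) u ⟩
      (scale a r ⊛ u) ⊕ ((0# ∷ (p ⊛ r)) ⊛ u)
    ≈⟨ ⊕-cong (scale-⊛ a r u) (≈-trans (0∷-⊛ (p ⊛ r) u) (∷-cong refl (⊛-assoc p r u))) ⟩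
      scale a (r ⊛ u) ⊕ (0# ∷ (p ⊛ (r ⊛ u)))
    ∎
    where open ≈-Reasoning

  const-⊛ : ∀ c r → ([ c ] ⊛ r) ≈ scale c r
  const-⊛ c r = ≈-trans (⊕-cong (≈-refl {scale c r}) (≈-sym []≈0)) (⊕-identityʳ (scale c r))

  ⊛-const : ∀ c r → (r ⊛ [ c ]) ≈ scale c r
  ⊛-const c r = ≈-trans (⊛-comm r [ c ]) (const-⊛ c r)

  one-⊛ : ∀ r → (one ⊛ r) ≈ r
  one-⊛ r = ≈-trans (const-⊛ 1# r) (scale-1 r)

  ⊛-one : ∀ r → (r ⊛ one) ≈ r
  ⊛-one r = ≈-trans (⊛-comm r one) (one-⊛ r)

  T-⊛ : ∀ p → (Tpoly ⊛ p) ≈ (0# ∷ p)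
  T-⊛ p = ≈-trans (0∷-⊛ one p) (∷-cong refl (one-⊛ p))

  ⊛-T : ∀ p → (p ⊛ Tpoly) ≈ (0# ∷ p)
  ⊛-T p = ≈-trans (⊛-comm p Tpoly) (T-⊛ p)

  ⊛-0∷ : ∀ p r → (p ⊛ (0# ∷ r)) ≈ (0# ∷ (p ⊛ r))
  ⊛-0∷ p r = ≈-trans (⊛-comm p (0# ∷ r)) (≈-trans (0∷-⊛ r p) (∷-cong refl (⊛-comm r p)))

  ⊛-shift : ∀ d p r → (p ⊛ shift d r) ≈ shift d (p ⊛ r)
  ⊛-shift zero    p r = ≈-refl
  ⊛-shift (suc d) p r = ≈-trans (⊛-0∷ p (shift d r)) (∷-cong refl (⊛-shift d p r))

  coeff-minus : ∀ p r n → coeff (p ⊕ negate r) n ≡ coeff p n + (- 1#) * coeff r n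
  coeff-minus p r n = trans (coeff-⊕ p (negate r) n) (cong (coeff p n +_) (coeff-negate r n))

  minus-zero : ∀ {p r} → (p ⊕ negate r) ≈ [] → p ≈ r
  minus-zero {p} {r} e = coeffwise λ n →
    difference-zero _ _ (trans (sym (coeff-minus p r n)) (at e n))

  ⊛-minus : ∀ h p r → (h ⊛ (p ⊕ negate r)) ≈ ((h ⊛ p) ⊕ negate (h ⊛ r))
  ⊛-minus h p r = ≈-trans (⊛-distribˡ h p (negate r)) (⊕-cong (≈-refl {h ⊛ p}) (⊛-scale (- 1#) h r))

  shift-minus : ∀ d p r → shift d (p ⊕ negate r) ≈ (shift d p ⊕ negate (shift d r))
  shift-minus zero    p r = ≈-refl
  shift-minus (suc d) p r =
    ∷-cong (sym (trans (cong (0# +_) (zeroʳ _)) (+-identityˡ 0#))) (shift-minus d p r)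

  record DegBelow (m : ℕ) (p : Poly) : Set where
    constructor degBelow
    field vanish : ∀ n → m ≤ n → coeff p n ≡ 0#
  open DegBelow

  record Monic (k : ℕ) (p : Poly) : Set where
    constructor monicOf
    field leading : coeff p k ≡ 1#
          bound   : DegBelow (suc k) p
  open Monic

  DegBelow-mono : ∀ {m m' p} → m ≤ m' → DegBelow m p → DegBelow m' p
  DegBelow-mono le b = degBelow λ n le' → vanish b n (ℕP.≤-trans le le')

  DegBelow-0 : ∀ {p} → DegBelow 0 p → p ≈ []
  DegBelow-0 b = coeffwise λ n → vanish b n z≤n

  DegBelow-1 : ∀ {p} → DegBelow 1 p → p ≈ [ coeff p 0 ]
  DegBelow-1 b = coeffwise λ { zero → refl ; (suc n) → vanish b (suc n) (s≤s z≤n) }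

  DegBelow-tail : ∀ {m} p → DegBelow (suc m) p → DegBelow m (tailP p)
  DegBelow-tail p b = degBelow λ n le → trans (coeff-tail p n) (vanish b (suc n) (s≤s le))

  DegBelow-length : ∀ p → DegBelow (length p) p
  DegBelow-length []      = degBelow λ _ _ → refl
  DegBelow-length (a ∷ p) = degBelow λ { (suc n) (s≤s le) → vanish (DegBelow-length p) n le }

  DegBelow-minus : ∀ {h p r} → DegBelow h p → DegBelow h r → DegBelow h (p ⊕ negate r)
  DegBelow-minus {p = p} {r} bp br = degBelow λ n le →
    trans (coeff-minus p r n)
      (trans (cong₂ (λ u v → u + (- 1#) * v) (vanish bp n le) (vanish br n le))
        (trans (cong (0# +_) (zeroʳ _)) (+-identityˡ 0#)))

  DegBelow-+0 : ∀ {k p} → DegBelow k p → DegBelow (k ℕ.+ 0) p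
  DegBelow-+0 {k} {p} = subst (λ z → DegBelow z p) (sym (ℕP.+-identityʳ k))

  DegBelow-+1 : ∀ {k p} → DegBelow (suc k) p → DegBelow (k ℕ.+ 1) p
  DegBelow-+1 {k} {p} = subst (λ z → DegBelow z p) (ℕP.+-comm 1 k)

  zero-or-leading : ∀ p → (p ≈ []) ⊎ (∃ λ d → (coeff p d ≢ 0#) × DegBelow (suc d) p)
  zero-or-leading [] = inj₁ ≈-refl
  zero-or-leading (a ∷ p) with zero-or-leading p
  ... | inj₂ (d , nz , b) = inj₂ (suc d , nz , degBelow λ { (suc n) (s≤s le) → vanish b n le })
  ... | inj₁ e with a ≟ 0#
  ...   | yes a0 = inj₁ (coeffwise λ { zero → a0 ; (suc n) → at e n })
  ...   | no an  = inj₂ (0 , an , degBelow λ { (suc n) _ → at e n })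

  leading-⊛ : ∀ p r m k → DegBelow (suc m) p → DegBelow (suc k) r →
              DegBelow (suc (m ℕ.+ k)) (p ⊛ r) × (coeff (p ⊛ r) (m ℕ.+ k) ≡ coeff p m * coeff r k)
  leading-⊛ []      r m k bp br = degBelow (λ _ _ → refl) , sym (zeroˡ _)
  leading-⊛ (a ∷ p) r zero k bp br = bnd , lead
    where
      rest-zero : ∀ n → coeff (0# ∷ (p ⊛ r)) n ≡ 0#
      rest-zero = at (0∷-zero (⊛-zeroˡ r (DegBelow-0 (DegBelow-tail (a ∷ p) bp))))
      bnd : DegBelow (suc k) ((a ∷ p) ⊛ r)
      bnd = degBelow λ n le →
        trans (coeff-⊛-∷ a p r n)
          (trans (cong₂ _+_ (cong (a *_) (vanish br n le)) (rest-zero n))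
            (trans (+-identityʳ _) (zeroʳ a)))
      lead : coeff ((a ∷ p) ⊛ r) k ≡ a * coeff r k
      lead = trans (coeff-⊛-∷ a p r k) (trans (cong (_ +_) (rest-zero k)) (+-identityʳ _))
  leading-⊛ (a ∷ p) r (suc m) k bp br = degBelow bnd , lead
    where
      ih = leading-⊛ p r m k (DegBelow-tail (a ∷ p) bp) br
      head-zero : ∀ n → suc m ℕ.+ k ≤ n → a * coeff r n ≡ 0#
      head-zero n le =
        trans (cong (a *_) (vanish br n (ℕP.≤-trans (ℕP.m≤n+m (suc k) m) (subst (_≤ n) (sym (ℕP.+-suc m k)) le))))
              (zeroʳ a)
      bnd : ∀ n → suc (suc m ℕ.+ k) ≤ n → coeff ((a ∷ p) ⊛ r) n ≡ 0#
      bnd (suc n) (s≤s le) =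
        trans (coeff-⊛-∷ a p r (suc n))
          (trans (cong₂ _+_ (head-zero (suc n) (ℕP.m≤n⇒m≤1+n le)) (vanish (proj₁ ih) n le))
                 (+-identityʳ _))
      lead : coeff ((a ∷ p) ⊛ r) (suc (m ℕ.+ k)) ≡ coeff p m * coeff r k
      lead = trans (coeff-⊛-∷ a p r (suc (m ℕ.+ k)))
               (trans (cong₂ _+_ (head-zero (suc (m ℕ.+ k)) ℕP.≤-refl) (proj₂ ih)) (+-identityˡ _))

  Monic-⊛ : ∀ {m k p r} → Monic m p → Monic k r → Monic (m ℕ.+ k) (p ⊛ r)
  Monic-⊛ {m} {k} {p} {r} mp mr =
    monicOf (trans (proj₂ lead) (trans (cong₂ _*_ (leading mp) (leading mr)) (*-identityˡ 1#)))
            (proj₁ lead)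
    where lead = leading-⊛ p r m k (bound mp) (bound mr)

  Monic-nonzero : ∀ {k K} → Monic k K → ¬ (K ≈ [])
  Monic-nonzero mK e = 1≢0 (trans (sym (leading mK)) (at e _))

  quotient-degree : ∀ {k K A M} j → Monic k K → (K ⊛ A) ≈ M → DegBelow (k ℕ.+ j) M → DegBelow j A
  quotient-degree {k} {K} {A} j mK e bM with zero-or-leading A
  ... | inj₁ A0 = degBelow λ n _ → at A0 n
  ... | inj₂ (d , nz , bA) with k ℕ.+ j ≤? k ℕ.+ d
  ...   | yes le = ⊥-elim (nz (begin
            coeff A d                  ≡⟨ sym (*-identityˡ _) ⟩
            1# * coeff A d             ≡⟨ cong (_* coeff A d) (sym (leading mK)) ⟩
            coeff K k * coeff A d      ≡⟨ sym (proj₂ (leading-⊛ K A k d (bound mK) bA)) ⟩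
            coeff (K ⊛ A) (k ℕ.+ d)    ≡⟨ at e (k ℕ.+ d) ⟩
            _                          ≡⟨ vanish bM _ le ⟩
            0#                         ∎))
    where open ≡-Reasoning
  ...   | no nle = DegBelow-mono (ℕP.+-cancelˡ-≤ k (suc d) j
                     (subst (_≤ k ℕ.+ j) (sym (ℕP.+-suc k d)) (ℕP.≰⇒> nle))) bA

  monic-cancel : ∀ {k K B} → Monic k K → (K ⊛ B) ≈ [] → B ≈ []
  monic-cancel mK e = DegBelow-0 (quotient-degree 0 mK e (degBelow λ _ _ → refl))

  infix 4 _∣_
  record _∣_ (d p : Poly) : Set where
    constructor divides
    field quotient : Poly
          product  : (d ⊛ quotient) ≈ p
  open _∣_

  ∣⇒∣ₚ : ∀ {d p} → d ∣ p → d ∣ₚ p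
  ∣⇒∣ₚ (divides s e) = s , at e

  ∣-refl : ∀ d → d ∣ d
  ∣-refl d = divides one (⊛-one d)

  ∣-resp-≈ : ∀ {d a b} → d ∣ a → a ≈ b → d ∣ b
  ∣-resp-≈ (divides s e) f = divides s (≈-trans e f)

  ∣-trans : ∀ {d a b} → d ∣ a → a ∣ b → d ∣ b
  ∣-trans {d} (divides s e) (divides t f) =
    divides (s ⊛ t) (≈-trans (≈-sym (⊛-assoc d s t)) (≈-trans (⊛-congˡ t e) f))

  ∣-⊛ʳ : ∀ {d a} c → d ∣ a → d ∣ (a ⊛ c)
  ∣-⊛ʳ {d} c (divides s e) = divides (s ⊛ c) (≈-trans (≈-sym (⊛-assoc d s c)) (⊛-congˡ c e))

  ∣-⊛ˡ : ∀ {d a} c → d ∣ a → d ∣ (c ⊛ a)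
  ∣-⊛ˡ {a = a} c h = ∣-resp-≈ (∣-⊛ʳ c h) (⊛-comm a c)

  ∣-⊕ : ∀ {d a b} → d ∣ a → d ∣ b → d ∣ (a ⊕ b)
  ∣-⊕ {d} (divides s e) (divides t f) = divides (s ⊕ t) (≈-trans (⊛-distribˡ d s t) (⊕-cong e f))

  ∣-scale : ∀ {d a} c → d ∣ a → d ∣ scale c a
  ∣-scale {d} c (divides s e) = divides (scale c s) (≈-trans (⊛-scale c d s) (scale-cong refl e))

  low-multiple : ∀ {k K Δ} → Monic k K → (d : K ∣ Δ) → DegBelow (suc k) Δ →
                 Δ ≈ scale (coeff (quotient d) 0) K
  low-multiple {K = K} mK (divides W e) bΔ =
    ≈-trans (≈-sym e)
      (≈-trans (⊛-congʳ K (DegBelow-1 (quotient-degree 1 mK e (DegBelow-+1 bΔ))))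
               (⊛-const (coeff W 0) K))

  monic-∣-equal : ∀ {k A B} → Monic k A → Monic k B → A ∣ B → A ≈ B
  monic-∣-equal {k} {A} {B} mA mB A∣B =
    ≈-sym (≈-trans B≈wA (≈-trans (scale-cong w≡1 ≈-refl) (scale-1 A)))
    where
      w = coeff (quotient A∣B) 0
      B≈wA = low-multiple mA A∣B (bound mB)
      w≡1 : w ≡ 1#
      w≡1 = begin
        w                   ≡⟨ sym (*-identityʳ w) ⟩
        w * 1#              ≡⟨ cong (w *_) (sym (leading mA)) ⟩
        w * coeff A k       ≡⟨ sym (coeff-scale w A k) ⟩
        coeff (scale w A) k ≡⟨ sym (at B≈wA k) ⟩
        coeff B k           ≡⟨ leading mB ⟩
        1#                  ∎
        where open ≡-Reasoning

  cancel-T : ∀ {K M} → coeff K 0 ≢ 0# → K ∣ (0# ∷ M) → K ∣ M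
  cancel-T {K} {M} nz (divides A e) =
    divides (tailP A) (tail-cong {0# ∷ (K ⊛ tailP A)} {0# ∷ M}
      (≈-trans (≈-sym (⊛-0∷ K (tailP A))) (≈-trans (⊛-congʳ K (≈-sym (≈0∷tail A A0))) e)))
    where
      A0 : coeff A 0 ≡ 0#
      A0 = no-zero-divisors (coeff K 0) (coeff A 0) nz (trans (sym (coeff0-⊛ K A)) (at e 0))

  cancel-Tⁿ : ∀ {K M} x → coeff K 0 ≢ 0# → K ∣ shift x M → K ∣ M
  cancel-Tⁿ zero    nz dv = dv
  cancel-Tⁿ (suc x) nz dv = cancel-Tⁿ x nz (cancel-T nz dv)

  cancel-T-factor : ∀ {K M} x → coeff K 0 ≢ 0# → (0# ∷ K) ∣ shift x M → K ∣ M
  cancel-T-factor {K} x nz dv = cancel-Tⁿ x nz (∣-trans (divides Tpoly (⊛-T K)) dv)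

  record Division (Q P : Poly) (m : ℕ) : Set where
    constructor division
    field quot rem   : Poly
          identity   : P ≈ ((Q ⊛ quot) ⊕ rem)
          rem-degree : DegBelow m rem

  monomial : ℕ → Carrier → Poly
  monomial d e = shift d [ e ]

  monomial-leading : ∀ d e → coeff (monomial d e) d ≡ e
  monomial-leading zero    e = refl
  monomial-leading (suc d) e = monomial-leading d e

  monomial-degree : ∀ d e → DegBelow (suc d) (monomial d e)
  monomial-degree zero    e = degBelow λ { (suc n) _ → refl }
  monomial-degree (suc d) e =
    degBelow λ { (suc n) (s≤s le) → vanish (monomial-degree d e) n le }

  reduce-step : ∀ Q m (nz : coeff Q m ≢ 0#) → DegBelow (suc m) Q → ∀ d k → m ℕ.+ d ≡ k →
                ∀ P → DegBelow (suc k) P →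
                DegBelow k (P ⊕ negate (Q ⊛ monomial d (coeff P k * inv (coeff Q m) nz)))
  reduce-step Q m nz bQ d k refl P bP = degBelow vanishes
    where
      e = coeff P k * inv (coeff Q m) nz
      X = Q ⊛ monomial d e
      leadX = leading-⊛ Q (monomial d e) m d bQ (monomial-degree d e)
      cancels : coeff P k + (- 1#) * coeff X k ≡ 0#
      cancels = begin
        coeff P k + (- 1#) * coeff X k                ≡⟨ cong (λ z → coeff P k + (- 1#) * z) (proj₂ leadX) ⟩
        coeff P k + (- 1#) * (coeff Q m * coeff (monomial d e) d)
                                                      ≡⟨ cong (λ z → coeff P k + (- 1#) * (coeff Q m * z)) (monomial-leading d e) ⟩
        coeff P k + (- 1#) * (coeff Q m * e)          ≡⟨ cong (λ z → coeff P k + (- 1#) * z) Qm*e ⟩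
        coeff P k + (- 1#) * coeff P k                ≡⟨ minus-cancelʳ _ ⟩
        0#                                            ∎
        where
          open ≡-Reasoning
          Qm*e : coeff Q m * e ≡ coeff P k
          Qm*e = trans (*-comm _ _) (trans (*-assoc _ _ _)
                   (trans (cong (coeff P k *_) (trans (*-comm _ _) (inv-correct _ nz))) (*-identityʳ _)))
      vanishes : ∀ n → k ≤ n → coeff (P ⊕ negate X) n ≡ 0#
      vanishes n k≤n with ℕP.m≤n⇒m<n∨m≡n k≤n
      ... | inj₂ refl = trans (coeff-minus P X k) cancels
      ... | inj₁ k<n  = trans (coeff-minus P X n)
            (trans (cong₂ (λ u v → u + (- 1#) * v) (vanish bP n k<n) (vanish (proj₁ leadX) n k<n))
              (trans (cong (0# +_) (zeroʳ _)) (+-identityˡ 0#)))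

  add-back : ∀ Q P X qq r → (P ⊕ negate (Q ⊛ X)) ≈ ((Q ⊛ qq) ⊕ r) → P ≈ ((Q ⊛ (qq ⊕ X)) ⊕ r)
  add-back Q P X qq r e = begin
      P
    ≈⟨ ≈-sym (≈-trans (⊕-assoc P (negate QX) QX)
                      (≈-trans (⊕-cong (≈-refl {P}) (negate-inverseˡ QX)) (⊕-identityʳ P))) ⟩
      (P ⊕ negate QX) ⊕ QX
    ≈⟨ ⊕-cong e (≈-refl {QX}) ⟩
      ((Q ⊛ qq) ⊕ r) ⊕ QX
    ≈⟨ ≈-trans (⊕-assoc (Q ⊛ qq) r QX)
               (≈-trans (⊕-cong (≈-refl {Q ⊛ qq}) (⊕-comm r QX)) (≈-sym (⊕-assoc (Q ⊛ qq) QX r))) ⟩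
      ((Q ⊛ qq) ⊕ QX) ⊕ r
    ≈⟨ ⊕-cong (≈-sym (⊛-distribˡ Q qq X)) (≈-refl {r}) ⟩
      (Q ⊛ (qq ⊕ X)) ⊕ r
    ∎
    where
      open ≈-Reasoning
      QX = Q ⊛ X

  divide : ∀ Q m → coeff Q m ≢ 0# → DegBelow (suc m) Q → ∀ n P → DegBelow n P → Division Q P m
  divide Q m nz bQ zero P bP =
    division [] P (≈-sym (⊕-cong (⊛-nilʳ Q) ≈-refl)) (DegBelow-mono z≤n bP)
  divide Q m nz bQ (suc k) P bP with m ≤? k
  ... | no m≰k = division [] P (≈-sym (⊕-cong (⊛-nilʳ Q) ≈-refl)) (DegBelow-mono (ℕP.≰⇒> m≰k) bP)
  ... | yes m≤k with ℕP.m≤n⇒∃[o]m+o≡n m≤k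
  ...   | d , m+d≡k =
    division (Division.quot D ⊕ X) (Division.rem D)
             (add-back Q P X (Division.quot D) (Division.rem D) (Division.identity D))
             (Division.rem-degree D)
    where
      X = monomial d (coeff P k * inv (coeff Q m) nz)
      D = divide Q m nz bQ k (P ⊕ negate (Q ⊛ X)) (reduce-step Q m nz bQ d k m+d≡k P bP)

  record Bezout (P Q : Poly) : Set where
    constructor bezoutOf
    field g A B   : Poly
          g∣P     : g ∣ P
          g∣Q     : g ∣ Q
          combine : ((A ⊛ P) ⊕ (B ⊛ Q)) ≈ g

  bezout-zero : ∀ P Q → Q ≈ [] → Bezout P Q
  bezout-zero P Q e =
    bezoutOf P one [] (∣-refl P) (divides [] (≈-trans (⊛-nilʳ P) (≈-sym e)))
             (≈-trans (⊕-identityʳ (one ⊛ P)) (one-⊛ P))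

  cancel-⊕-minus : ∀ X Y Z → ((X ⊕ Y) ⊕ (Z ⊕ negate X)) ≈ (Z ⊕ Y)
  cancel-⊕-minus X Y Z = coeffwise λ n →
    trans (coeff-⊕ (X ⊕ Y) (Z ⊕ negate X) n)
      (trans (cong₂ _+_ (coeff-⊕ X Y n) (coeff-minus Z X n))
        (trans (scalar (coeff X n) (coeff Y n) (coeff Z n)) (sym (coeff-⊕ Z Y n))))
    where
      scalar : ∀ x y z → (x + y) + (z + (- 1#) * x) ≡ z + y
      scalar x y z = begin
        (x + y) + (z + (- 1#) * x)   ≡⟨ cong ((x + y) +_) (+-comm z _) ⟩
        (x + y) + ((- 1#) * x + z)   ≡⟨ sym (+-assoc (x + y) _ z) ⟩
        ((x + y) + (- 1#) * x) + z   ≡⟨ cong (_+ z) (+-comm (x + y) _) ⟩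
        ((- 1#) * x + (x + y)) + z   ≡⟨ cong (_+ z) (sym (+-assoc _ x y)) ⟩
        (((- 1#) * x + x) + y) + z   ≡⟨ cong (λ u → (u + y) + z) (minus-cancelˡ x) ⟩
        (0# + y) + z                 ≡⟨ cong (_+ z) (+-identityˡ y) ⟩
        y + z                        ≡⟨ +-comm y z ⟩
        z + y                        ∎
        where open ≡-Reasoning

  -- the Euclidean algorithm, by induction on a degree bound for Q:
  -- writing P = Q·qq + r, a Bézout relation for (Q, r) yields one for (P, Q)
  bezout : ∀ n P Q → DegBelow n Q → Bezout P Q
  bezout zero    P Q b = bezout-zero P Q (DegBelow-0 b)
  bezout (suc k) P Q b with zero-or-leading Q
  ... | inj₁ e = bezout-zero P Q e
  ... | inj₂ (m , nz , bm) = bezoutOf g B (A ⊕ negate (B ⊛ qq)) g∣P (Bezout.g∣P rec) combine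
    where
      m≤k : m ≤ k
      m≤k with m ≤? k
      ... | yes le  = le
      ... | no  m≰k = ⊥-elim (nz (vanish b m (ℕP.≰⇒> m≰k)))
      D   = divide Q m nz bm (length P) P (DegBelow-length P)
      qq  = Division.quot D
      r   = Division.rem D
      rec = bezout k Q r (DegBelow-mono m≤k (Division.rem-degree D))
      g   = Bezout.g rec
      A   = Bezout.A rec
      B   = Bezout.B rec
      g∣P : g ∣ P
      g∣P = ∣-resp-≈ (∣-⊕ (∣-⊛ʳ qq (Bezout.g∣P rec)) (Bezout.g∣Q rec)) (≈-sym (Division.identity D))
      X = B ⊛ (Q ⊛ qq)
      combine : ((B ⊛ P) ⊕ ((A ⊕ negate (B ⊛ qq)) ⊛ Q)) ≈ g
      combine = begin
          (B ⊛ P) ⊕ ((A ⊕ negate (B ⊛ qq)) ⊛ Q)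
        ≈⟨ ⊕-cong (≈-trans (⊛-congʳ B (Division.identity D)) (⊛-distribˡ B (Q ⊛ qq) r))
                  (≈-trans (⊛-distribʳ A (negate (B ⊛ qq)) Q)
                    (⊕-cong (≈-refl {A ⊛ Q})
                      (≈-trans (scale-⊛ (- 1#) (B ⊛ qq) Q)
                        (scale-cong refl (≈-trans (⊛-assoc B qq Q) (⊛-congʳ B (⊛-comm qq Q))))))) ⟩
          (X ⊕ (B ⊛ r)) ⊕ ((A ⊛ Q) ⊕ negate X)
        ≈⟨ cancel-⊕-minus X (B ⊛ r) (A ⊛ Q) ⟩
          (A ⊛ Q) ⊕ (B ⊛ r)
        ≈⟨ Bezout.combine rec ⟩
          g
        ∎
        where open ≈-Reasoning

  -- Gauss' lemma: a monic K coprime to P with K ∣ P·M divides M.  The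
  -- Bézout combination g of P and K is a nonzero constant g₀, and
  -- g₀·M = A·P·M + B·K·M is divisible by K.
  gauss : ∀ {k P K M} → Coprime P K → Monic k K → K ∣ (P ⊛ M) → K ∣ M
  gauss {k} {P} {K} {M} coprime mK K∣PM = ∣-resp-≈ (∣-scale (inv g₀ g₀≢0) K∣g₀M) g₀⁻¹g₀M≈M
    where
      Z = bezout (suc k) P K (bound mK)
      open Bezout Z using (g; A; B)
      g₀ = coeff g 0
      g≈g₀ : g ≈ [ g₀ ]
      g≈g₀ = coeffwise λ { zero → refl
                         ; (suc n) → coprime g (∣⇒∣ₚ (Bezout.g∣P Z)) (∣⇒∣ₚ (Bezout.g∣Q Z)) n }
      g₀≢0 : g₀ ≢ 0#
      g₀≢0 g₀≡0 = Monic-nonzero mK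
        (≈-trans (≈-sym (product (Bezout.g∣Q Z)))
                 (⊛-zeroˡ (quotient (Bezout.g∣Q Z)) (≈-trans g≈g₀ (≈-trans (∷-cong g₀≡0 ≈-refl) (≈-sym []≈0)))))
      K∣g₀M : K ∣ scale g₀ M
      K∣g₀M = ∣-resp-≈ (∣-⊕ (∣-resp-≈ (∣-⊛ˡ A K∣PM) (≈-sym (⊛-assoc A P M))) (∣-⊛ʳ M (∣-⊛ˡ B (∣-refl K))))
                (≈-trans (≈-sym (⊛-distribʳ (A ⊛ P) (B ⊛ K) M))
                  (≈-trans (⊛-congˡ M (Bezout.combine Z)) (≈-trans (⊛-congˡ M g≈g₀) (const-⊛ g₀ M))))
      g₀⁻¹g₀M≈M : scale (inv g₀ g₀≢0) (scale g₀ M) ≈ M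
      g₀⁻¹g₀M≈M = ≈-trans (scale-scale _ _ M)
                    (≈-trans (scale-cong (trans (*-comm _ _) (inv-correct g₀ g₀≢0)) (≈-refl {M})) (scale-1 M))

  -- Laurent tails.  A tail w ∈ U stands for Σ_k w_k T^(-(k+1)).
  -- advance n w is the fractional part of T^n·w.
  advance : ℕ → U → U
  advance n w i = w (i ℕ.+ n)

  -- residue P w: the coefficient of T^(-1) in P·w, i.e. Σ_i P_i w_i
  residue : Poly → U → Carrier
  residue []      w = 0#
  residue (a ∷ p) w = a * w 0 + residue p (λ i → w (suc i))

  -- polyPart P w: the polynomial part of P·w; its coefficient of T^n
  -- is Σ_i P_(i+n+1) w_i
  polyPart : Poly → U → Poly
  polyPart []      w = []
  polyPart (a ∷ p) w = residue p w ∷ polyPart p w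

  -- P annihilates w when P·w is a polynomial, i.e. every coefficient of a
  -- negative power of T in P·w vanishes
  Annihilates : Poly → U → Set
  Annihilates P w = ∀ n → residue P (advance n w) ≡ 0#

  sumTo-cong : ∀ L {f g : ℕ → Carrier} → (∀ i → f i ≡ g i) → sumTo L f ≡ sumTo L g
  sumTo-cong zero    e = refl
  sumTo-cong (suc L) e = cong₂ _+_ (sumTo-cong L e) (e L)

  sumTo-suc : ∀ L f → sumTo (suc L) f ≡ f 0 + sumTo L (λ i → f (suc i))
  sumTo-suc zero    f = trans (+-identityˡ _) (sym (+-identityʳ _))
  sumTo-suc (suc L) f = trans (cong (_+ f (suc L)) (sumTo-suc L f)) (+-assoc _ _ _)

  sumTo-zero : ∀ L (f : ℕ → Carrier) → (∀ i → f i ≡ 0#) → sumTo L f ≡ 0#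
  sumTo-zero zero    f e = refl
  sumTo-zero (suc L) f e = trans (cong₂ _+_ (sumTo-zero L f e) (e L)) (+-identityˡ 0#)

  sumTo-residue : ∀ P L w → length P ≤ L → sumTo L (λ i → coeff P i * w i) ≡ residue P w
  sumTo-residue []      L       w _        = sumTo-zero L _ (λ i → zeroˡ _)
  sumTo-residue (a ∷ P) (suc L) w (s≤s le) =
    trans (sumTo-suc L _) (cong (a * w 0 +_) (sumTo-residue P L (λ i → w (suc i)) le))

  residue-congʳ : ∀ P {w w'} → (∀ i → w i ≡ w' i) → residue P w ≡ residue P w'
  residue-congʳ []      e = refl
  residue-congʳ (a ∷ p) e = cong₂ _+_ (cong (a *_) (e 0)) (residue-congʳ p (λ i → e (suc i)))

  residue-congˡ : ∀ {P P'} w → P ≈ P' → residue P w ≡ residue P' w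
  residue-congˡ {P} {P'} w e = begin
    residue P w                          ≡⟨ sym (sumTo-residue P L w (ℕP.m≤m⊔n _ _)) ⟩
    sumTo L (λ i → coeff P i * w i)      ≡⟨ sumTo-cong L (λ i → cong (_* w i) (at e i)) ⟩
    sumTo L (λ i → coeff P' i * w i)     ≡⟨ sumTo-residue P' L w (ℕP.m≤n⊔m _ _) ⟩
    residue P' w                         ∎
    where
      open ≡-Reasoning
      L = length P ℕ.⊔ length P'

  residue-terms-zero : ∀ P w → (∀ i → coeff P i * w i ≡ 0#) → residue P w ≡ 0#
  residue-terms-zero []      w e = refl
  residue-terms-zero (a ∷ p) w e =
    trans (cong₂ _+_ (e 0) (residue-terms-zero p (λ i → w (suc i)) (λ i → e (suc i)))) (+-identityˡ 0#)

  residue-of-zero : ∀ P {w} → (∀ i → w i ≡ 0#) → residue P w ≡ 0#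
  residue-of-zero P {w} e = residue-terms-zero P w (λ i → trans (cong (coeff P i *_) (e i)) (zeroʳ _))

  residue-single : ∀ P w m → (∀ i → i ≢ m → coeff P i * w i ≡ 0#) → residue P w ≡ coeff P m * w m
  residue-single []      w m       h = sym (zeroˡ _)
  residue-single (a ∷ p) w zero    h =
    trans (cong (a * w 0 +_) (residue-terms-zero p (λ i → w (suc i)) (λ i → h (suc i) (λ ()))))
          (+-identityʳ _)
  residue-single (a ∷ p) w (suc m) h =
    trans (cong₂ _+_ (h 0 (λ ()))
                     (residue-single p (λ i → w (suc i)) m (λ i ne → h (suc i) (λ e → ne (ℕP.suc-injective e)))))
          (+-identityˡ _)

  residue-⊕ : ∀ A B w → residue (A ⊕ B) w ≡ residue A w + residue B w
  residue-⊕ []      B       w = sym (+-identityˡ _)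
  residue-⊕ (a ∷ A) []      w = sym (+-identityʳ _)
  residue-⊕ (a ∷ A) (b ∷ B) w =
    trans (cong₂ _+_ (distribʳ (w 0) a b) (residue-⊕ A B (λ i → w (suc i)))) (interchange _ _ _ _)

  residue-scale : ∀ c A w → residue (scale c A) w ≡ c * residue A w
  residue-scale c []      w = sym (zeroʳ c)
  residue-scale c (a ∷ A) w =
    trans (cong₂ _+_ (*-assoc c a (w 0)) (residue-scale c A (λ i → w (suc i)))) (sym (distribˡ c _ _))

  residue-minusʳ : ∀ P u v → residue P (λ i → u i + (- 1#) * v i) ≡ residue P u + (- 1#) * residue P v
  residue-minusʳ []      u v = sym (trans (cong (0# +_) (zeroʳ _)) (+-identityˡ 0#))
  residue-minusʳ (a ∷ p) u v =
    trans (cong₂ _+_ (trans (distribˡ a _ _) (cong (a * u 0 +_) (*-swap a (- 1#) (v 0))))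
                     (residue-minusʳ p (λ i → u (suc i)) (λ i → v (suc i))))
      (trans (interchange _ _ _ _)
        (cong (a * u 0 + residue p (λ i → u (suc i)) +_) (sym (distribˡ (- 1#) _ _))))
    where
      *-swap : ∀ x y z → x * (y * z) ≡ y * (x * z)
      *-swap x y z = trans (sym (*-assoc x y z)) (trans (cong (_* z) (*-comm x y)) (*-assoc y x z))

  residue-⊛ : ∀ Q P w → residue (Q ⊛ P) w ≡ residue Q (λ i → residue P (advance i w))
  residue-⊛ []      P w = refl
  residue-⊛ (a ∷ Q) P w =
    trans (residue-⊕ (scale a P) (0# ∷ (Q ⊛ P)) w)
      (cong₂ _+_
        (trans (residue-scale a P w) (cong (a *_) (residue-congʳ P (λ j → cong w (sym (ℕP.+-identityʳ j))))))
        (trans (cong₂ _+_ (zeroˡ _) (residue-⊛ Q P (λ i → w (suc i))))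
          (trans (+-identityˡ _)
            (residue-congʳ Q (λ i → residue-congʳ P (λ j → cong w (sym (ℕP.+-suc j i))))))))

  coeff-drop : ∀ k H i → coeff (drop k H) i ≡ coeff H (k ℕ.+ i)
  coeff-drop zero    H       i = refl
  coeff-drop (suc k) []      i = refl
  coeff-drop (suc k) (a ∷ H) i = coeff-drop k H i

  coeff-polyPart : ∀ H w n → coeff (polyPart H w) n ≡ residue (drop (suc n) H) w
  coeff-polyPart []      w n       = refl
  coeff-polyPart (a ∷ H) w zero    = refl
  coeff-polyPart (a ∷ H) w (suc n) = coeff-polyPart H w n

  polyPart-congʳ : ∀ P {w w'} → (∀ i → w i ≡ w' i) → polyPart P w ≈ polyPart P w'
  polyPart-congʳ []      e = ≈-refl
  polyPart-congʳ (a ∷ p) e = ∷-cong (residue-congʳ p e) (polyPart-congʳ p e)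

  polyPart-congˡ : ∀ {P P'} w → P ≈ P' → polyPart P w ≈ polyPart P' w
  polyPart-congˡ {P} {P'} w e = coeffwise λ n →
    trans (coeff-polyPart P w n)
      (trans (residue-congˡ {drop (suc n) P} {drop (suc n) P'} w (coeffwise λ i →
                trans (coeff-drop (suc n) P i) (trans (at e (suc n ℕ.+ i)) (sym (coeff-drop (suc n) P' i)))))
             (sym (coeff-polyPart P' w n)))

  polyPart-⊕ : ∀ A B w → polyPart (A ⊕ B) w ≈ (polyPart A w ⊕ polyPart B w)
  polyPart-⊕ []      B       w = ≈-refl
  polyPart-⊕ (a ∷ A) []      w = ≈-sym (⊕-identityʳ _)
  polyPart-⊕ (a ∷ A) (b ∷ B) w = ∷-cong (residue-⊕ A B w) (polyPart-⊕ A B w)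

  polyPart-scale : ∀ c A w → polyPart (scale c A) w ≈ scale c (polyPart A w)
  polyPart-scale c []      w = ≈-refl
  polyPart-scale c (a ∷ A) w = ∷-cong (residue-scale c A w) (polyPart-scale c A w)

  -- T·(P·w) = w₀·P + P·(advance 1 w), split into polynomial parts
  polyPart-T : ∀ P w →
    (residue P w ∷ polyPart P w) ≈ (scale (w 0) P ⊕ polyPart P (λ i → w (suc i)))
  polyPart-T []      w = ≈-sym []≈0
  polyPart-T (a ∷ p) w = ∷-cong (cong (_+ residue p (λ i → w (suc i))) (*-comm a (w 0))) (polyPart-T p w)

  -- if P annihilates w then (Q·P)·w = Q·(P·w) has polynomial part Q·polyPart P w
  polyPart-⊛ : ∀ Q P w → Annihilates P w → (Q ⊛ polyPart P w) ≈ polyPart (Q ⊛ P) w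
  polyPart-⊛ []      P w ann = ≈-refl
  polyPart-⊛ (a ∷ Q) P w ann = ≈-sym (≈-trans (polyPart-⊕ (scale a P) (0# ∷ (Q ⊛ P)) w)
    (⊕-cong (polyPart-scale a P w)
            (∷-cong (trans (residue-⊛ Q P w) (residue-of-zero Q ann)) (≈-sym (polyPart-⊛ Q P w ann)))))

  annihilates-⊛ : ∀ P Q w → Annihilates Q w → Annihilates (P ⊛ Q) w
  annihilates-⊛ P Q w ann n =
    trans (residue-⊛ P Q (advance n w))
      (residue-of-zero P (λ i →
        trans (residue-congʳ Q (λ j → cong w (ℕP.+-assoc j i n))) (ann (i ℕ.+ n))))

  annihilates-cong : ∀ {P P'} w → P ≈ P' → Annihilates P w → Annihilates P' w
  annihilates-cong w e ann n = trans (sym (residue-congˡ (advance n w) e)) (ann n)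

  annihilates-minus : ∀ P u v → Annihilates P u → Annihilates P v →
                      Annihilates P (λ k → u k + (- 1#) * v k)
  annihilates-minus P u v au av n =
    trans (residue-minusʳ P (advance n u) (advance n v))
      (trans (cong₂ (λ x y → x + (- 1#) * y) (au n) (av n))
             (trans (cong (0# +_) (zeroʳ _)) (+-identityˡ 0#)))

  annihilates-advance : ∀ P w x → Annihilates P w → Annihilates P (advance x w)
  annihilates-advance P w x ann n =
    trans (residue-congʳ P (λ i → cong w (ℕP.+-assoc i n x))) (ann (n ℕ.+ x))

  -- A tail annihilated by a monic P of degree m satisfies a linear recurrence
  -- of order m: if its first m coefficients vanish, it vanishes.
  recurrence-zero : ∀ P m u → Monic m P → Annihilates P u → (∀ k → k < m → u k ≡ 0#) →
                    ∀ n → u n ≡ 0#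
  recurrence-zero P m u mP ann initial n = below (suc n) n ℕP.≤-refl
    where
      below : ∀ N n → n < N → u n ≡ 0#
      below (suc N) n (s≤s n≤N) with n <? m
      ... | yes n<m = initial n n<m
      ... | no  n≮m with ℕP.m≤n⇒∃[o]m+o≡n (ℕP.≮⇒≥ n≮m)
      ...   | d , m+d≡n = begin
          u n                                ≡⟨ sym (*-identityˡ _) ⟩
          1# * u n                           ≡⟨ cong (_* u n) (sym (leading mP)) ⟩
          coeff P m * u n                    ≡⟨ cong (λ z → coeff P m * u z) (sym m+d≡n) ⟩
          coeff P m * advance d u m          ≡⟨ sym (residue-single P (advance d u) m others) ⟩
          residue P (advance d u)            ≡⟨ ann d ⟩
          0#                                 ∎
        where
          open ≡-Reasoning
          -- lower terms vanish by induction, higher ones since deg P = m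
          others : ∀ i → i ≢ m → coeff P i * u (i ℕ.+ d) ≡ 0#
          others i i≢m with ℕP.<-cmp i m
          ... | tri< i<m _ _ = trans (cong (coeff P i *_)
                  (below N (i ℕ.+ d) (ℕP.≤-trans (ℕP.+-monoˡ-< d i<m) (subst (_≤ N) (sym m+d≡n) n≤N))))
                  (zeroʳ _)
          ... | tri≈ _ i≡m _ = ⊥-elim (i≢m i≡m)
          ... | tri> _ _ m<i = trans (cong (_* u (i ℕ.+ d)) (vanish (bound mP) i m<i)) (zeroˡ _)

  -- Two tails annihilated by monic polynomials of degree h that agree in
  -- their first 2h coefficients are equal: their difference is annihilated
  -- by the product, which is monic of degree 2h.
  tails-equal : ∀ {h H₁ H₂} t₁ t₂ → Monic h H₁ → Monic h H₂ →
                Annihilates H₁ t₁ → Annihilates H₂ t₂ →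
                (∀ k → k < h ℕ.+ h → t₁ k ≡ t₂ k) → ∀ n → t₁ n ≡ t₂ n
  tails-equal {h} {H₁} {H₂} t₁ t₂ m₁ m₂ a₁ a₂ agree n =
    difference-zero _ _ (recurrence-zero (H₁ ⊛ H₂) (h ℕ.+ h) u (Monic-⊛ m₁ m₂) ann
      (λ k lt → trans (cong (_+ (- 1#) * t₂ k) (agree k lt)) (minus-cancelʳ _)) n)
    where
      u = λ k → t₁ k + (- 1#) * t₂ k
      ann : Annihilates (H₁ ⊛ H₂) u
      ann = annihilates-minus (H₁ ⊛ H₂) t₁ t₂
              (annihilates-cong t₁ (⊛-comm H₂ H₁) (annihilates-⊛ H₂ H₁ t₁ a₁))
              (annihilates-⊛ H₁ H₂ t₂ a₂)

  -- Expansions G/H = s.  truncation s N = Σ_{k<N} s_k T^(N-1-k) is the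
  -- polynomial part of T^N·s.
  truncation : U → ℕ → Poly
  truncation s zero    = []
  truncation s (suc N) = s N ∷ truncation s N

  coeff-truncation : ∀ s n → coeff (truncation s (suc n)) n ≡ s 0
  coeff-truncation s zero    = refl
  coeff-truncation s (suc n) = coeff-truncation s n

  expansion-polyPart : ∀ H s G → (∀ n → prodCoeffPos H s n ≡ coeff G n) → G ≈ polyPart H s
  expansion-polyPart H s G e = coeffwise λ n → begin
    coeff G n
      ≡⟨ sym (e n) ⟩
    sumTo (length H) (λ i → coeff H (suc (i ℕ.+ n)) * s i)
      ≡⟨ sumTo-cong (length H) (λ i → cong (_* s i)
           (trans (cong (λ z → coeff H (suc z)) (ℕP.+-comm i n)) (sym (coeff-drop (suc n) H i)))) ⟩
    sumTo (length H) (λ i → coeff (drop (suc n) H) i * s i)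
      ≡⟨ sumTo-residue (drop (suc n) H) (length H) s
           (subst (_≤ length H) (sym (ListP.length-drop (suc n) H)) (ℕP.m∸n≤m (length H) (suc n))) ⟩
    residue (drop (suc n) H) s
      ≡⟨ sym (coeff-polyPart H s n) ⟩
    coeff (polyPart H s) n
      ∎
    where open ≡-Reasoning

  expansion-annihilates : ∀ H s → (∀ n → prodCoeffNeg H s n ≡ 0#) → Annihilates H s
  expansion-annihilates H s e n =
    trans (sym (sumTo-residue H (length H) (advance n s) ℕP.≤-refl)) (e n)

  -- If H·s = G then T^N·G = H·(truncation s N) + H·(advance N s), and the
  -- last product is the polynomial polyPart H (advance N s).
  shifted-expansion : ∀ H G s → Annihilates H s → G ≈ polyPart H s → ∀ N →
                      shift N G ≈ ((H ⊛ truncation s N) ⊕ polyPart H (advance N s))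
  shifted-expansion H G s ann G≈ zero =
    ≈-trans G≈ (≈-trans (polyPart-congʳ H (λ k → cong s (sym (ℕP.+-identityʳ k))))
                        (≈-sym (⊕-cong (⊛-nilʳ H) ≈-refl)))
  shifted-expansion H G s ann G≈ (suc N) = begin
      0# ∷ shift N G
    ≈⟨ ∷-cong refl (shifted-expansion H G s ann G≈ N) ⟩
      0# ∷ (HS ⊕ R)
    ≈⟨ ≈-sym (0∷-⊕ HS R) ⟩
      (0# ∷ HS) ⊕ (0# ∷ R)
    ≈⟨ ⊕-cong (≈-refl {0# ∷ HS}) (≈-trans (∷-cong (sym (ann N)) ≈-refl) (polyPart-T H (advance N s))) ⟩
      (0# ∷ HS) ⊕ (scale (s N) H ⊕ R')
    ≈⟨ ≈-sym (⊕-assoc (0# ∷ HS) (scale (s N) H) R') ⟩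
      ((0# ∷ HS) ⊕ scale (s N) H) ⊕ R'
    ≈⟨ ⊕-cong (≈-trans (⊕-comm (0# ∷ HS) (scale (s N) H)) (≈-sym (⊛-∷ʳ H (s N) (truncation s N))))
              (polyPart-congʳ H (λ k → cong s (sym (ℕP.+-suc k N)))) ⟩
      (H ⊛ truncation s (suc N)) ⊕ polyPart H (advance (suc N) s)
    ∎
    where
      open ≈-Reasoning
      HS = H ⊛ truncation s N
      R  = polyPart H (advance N s)
      R' = polyPart H (λ i → advance N s (suc i))

  monic-Monic : ∀ {h} (a : Vec Carrier h) → Monic h (monic a)
  monic-Monic []ᵥ       = monicOf refl (degBelow λ { (suc n) _ → refl })
  monic-Monic (x ∷ᵥ a) =
    monicOf (leading (monic-Monic a)) (degBelow λ { (suc n) (s≤s le) → vanish (bound (monic-Monic a)) n le })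

  toList-degree : ∀ {h} (g : Vec Carrier h) → DegBelow h (toList g)
  toList-degree []ᵥ       = degBelow λ _ _ → refl
  toList-degree (x ∷ᵥ g) = degBelow λ { (suc n) (s≤s le) → vanish (toList-degree g) n le }

  toList-injective : ∀ {n} (g g' : Vec Carrier n) → toList g ≈ toList g' → g ≡ g'
  toList-injective []ᵥ       []ᵥ         e = refl
  toList-injective (x ∷ᵥ g) (y ∷ᵥ g') e =
    cong₂ _∷ᵥ_ (at e 0) (toList-injective g g' (tail-cong {x ∷ toList g} {y ∷ toList g'} e))

  monic-injective : ∀ {n} (a a' : Vec Carrier n) → monic a ≈ monic a' → a ≡ a'
  monic-injective []ᵥ       []ᵥ         e = refl
  monic-injective (x ∷ᵥ a) (y ∷ᵥ a') e =
    cong₂ _∷ᵥ_ (at e 0) (monic-injective a a' (tail-cong {monic (x ∷ᵥ a)} {monic (y ∷ᵥ a')} e))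

  data TShape (h : ℕ) (H : Poly) : Set where
    T∤H  : coeff H 0 ≢ 0# → TShape h H
    H≡TK : ∀ {k} K → suc k ≡ h → Monic k K → coeff K 0 ≢ 0# → H ≡ (0# ∷ K) → TShape h H

  T²∤ : ∀ {k} (a : Vec Carrier k) → Squarefree (0# ∷ monic a) → coeff (monic a) 0 ≢ 0#
  T²∤ []ᵥ        sq = 1≢0
  T²∤ (b ∷ᵥ a) sq b≡0 = 0≢1 (sym (sq Tpoly (∣⇒∣ₚ {Tpoly ⊛ Tpoly} (divides (monic a) T²M≈H)) 0))
    where
      M = monic a
      T²M≈H : ((Tpoly ⊛ Tpoly) ⊛ M) ≈ (0# ∷ b ∷ M)
      T²M≈H = ≈-trans (⊛-assoc Tpoly Tpoly M)
                (≈-trans (⊛-congʳ Tpoly (T-⊛ M))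
                  (≈-trans (T-⊛ (0# ∷ M)) (∷-cong refl (∷-cong (sym b≡0) ≈-refl))))

  squarefree-shape : ∀ {h} (a : Vec Carrier h) → Squarefree (monic a) → ¬ (monic a ≈ₚ [ 1# ]) →
                     TShape h (monic a)
  squarefree-shape []ᵥ         sq ≢1 = ⊥-elim (≢1 (λ _ → refl))
  squarefree-shape (a₀ ∷ᵥ a') sq ≢1 with a₀ ≟ 0#
  ... | no  a₀≢0 = T∤H a₀≢0
  ... | yes refl = H≡TK (monic a') refl (monic-Monic a') (T²∤ a' sq) refl

  -- Two monic H₁, H₂ of degree h, not divisible by T², with H₁ ∣ T^x·H₂ and
  -- H₂ ∣ T^x·H₁, are equal: cancelling powers of T leaves mutual
  -- divisibility of monic polynomials of equal degree.
  denominators-equal : ∀ {h x H₁ H₂} → TShape h H₁ → TShape h H₂ → Monic h H₁ → Monic h H₂ →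
                       H₁ ∣ shift x H₂ → H₂ ∣ shift x H₁ → H₁ ≈ H₂
  denominators-equal {x = x} (T∤H nz) _ m₁ m₂ d₁₂ _ = monic-∣-equal m₁ m₂ (cancel-Tⁿ x nz d₁₂)
  denominators-equal {x = x} {H₂ = H₂} (H≡TK K₁ refl mK₁ _ refl) (T∤H nz) _ m₂ _ d₂₁ =
    ⊥-elim (Monic-nonzero mK₁ (≈-trans (≈-sym (product H₂∣K₁))
                                        (≈-trans (⊛-congʳ H₂ W≈0) (⊛-nilʳ H₂))))
    where
      -- H₂ ∣ K₁ with deg K₁ < deg H₂ forces K₁ = 0
      H₂∣K₁ = cancel-T nz (cancel-Tⁿ x nz d₂₁)
      W≈0 = DegBelow-0 (quotient-degree 0 m₂ (product H₂∣K₁) (DegBelow-+0 (bound mK₁)))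
  denominators-equal {x = x} (H≡TK K₁ refl mK₁ K₁0≢0 refl) (H≡TK K₂ e mK₂ _ refl) _ _ d₁₂ _
    with ℕP.suc-injective e
  ... | refl = ∷-cong refl (monic-∣-equal mK₁ mK₂ (cancel-T K₁0≢0 (cancel-T-factor x K₁0≢0 d₁₂)))

  monic-cancelˡ : ∀ {k K A B} → Monic k K → (K ⊛ A) ≈ (K ⊛ B) → A ≈ B
  monic-cancelˡ {K = K} {A} {B} mK e = minus-zero (monic-cancel mK (begin
      K ⊛ (A ⊕ negate B)
    ≈⟨ ⊛-minus K A B ⟩
      (K ⊛ A) ⊕ negate (K ⊛ B)
    ≈⟨ ⊕-cong e (≈-refl {negate (K ⊛ B)}) ⟩
      (K ⊛ B) ⊕ negate (K ⊛ B)
    ≈⟨ ⊕-comm (K ⊛ B) _ ⟩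
      negate (K ⊛ B) ⊕ (K ⊛ B)
    ≈⟨ negate-inverseˡ (K ⊛ B) ⟩
      []
    ∎))
    where open ≈-Reasoning

  minus-common : ∀ A B R → ((A ⊕ R) ⊕ negate (B ⊕ R)) ≈ (A ⊕ negate B)
  minus-common A B R = coeffwise λ n →
    trans (coeff-minus (A ⊕ R) (B ⊕ R) n)
      (trans (cong₂ (λ u v → u + (- 1#) * v) (coeff-⊕ A R n) (coeff-⊕ B R n))
        (trans (scalar (coeff A n) (coeff B n) (coeff R n)) (sym (coeff-minus A B n))))
    where
      scalar : ∀ a b r → (a + r) + (- 1#) * (b + r) ≡ a + (- 1#) * b
      scalar a b r = begin
        (a + r) + (- 1#) * (b + r)                 ≡⟨ cong ((a + r) +_) (distribˡ (- 1#) b r) ⟩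
        (a + r) + ((- 1#) * b + (- 1#) * r)        ≡⟨ interchange a r _ _ ⟩
        (a + (- 1#) * b) + (r + (- 1#) * r)        ≡⟨ cong ((a + (- 1#) * b) +_) (minus-cancelʳ r) ⟩
        (a + (- 1#) * b) + 0#                      ≡⟨ +-identityʳ _ ⟩
        a + (- 1#) * b                             ∎
        where open ≡-Reasoning

  shifted-difference : ∀ x {H G₁ G₂ S₁ S₂ R} →
                       shift x G₁ ≈ ((H ⊛ S₁) ⊕ R) → shift x G₂ ≈ ((H ⊛ S₂) ⊕ R) →
                       shift x (G₁ ⊕ negate G₂) ≈ (H ⊛ (S₁ ⊕ negate S₂))
  shifted-difference x {H} {G₁} {G₂} {S₁} {S₂} {R} e₁ e₂ =
    ≈-trans (shift-minus x G₁ G₂)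
      (≈-trans (⊕-cong e₁ (scale-cong refl e₂))
        (≈-trans (minus-common (H ⊛ S₁) (H ⊛ S₂) R) (≈-sym (⊛-minus H S₁ S₂))))

  TopVanishes : ℕ → Poly → Set
  TopVanishes zero     E = ⊤
  TopVanishes (suc x') E = coeff E x' ≡ 0#

  -- If deg Δ < h and T^x·Δ = H·E for H monic of degree h not divisible by
  -- T², then Δ = 0.  When T ∤ H this is a degree count.  When H = T·K we
  -- only get Δ = c·K, and c = 0 needs the extra condition TopVanishes x E.
  multiple-zero : ∀ {h} x {H Δ E} → TShape h H → Monic h H → DegBelow h Δ →
                  shift x Δ ≈ (H ⊛ E) → TopVanishes x E → Δ ≈ []
  multiple-zero x {H} {Δ} {E} (T∤H nz) mH bΔ e _ =
    ≈-trans (≈-sym (product H∣Δ))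
      (≈-trans (⊛-congʳ H (DegBelow-0 (quotient-degree 0 mH (product H∣Δ) (DegBelow-+0 bΔ))))
               (⊛-nilʳ H))
    where H∣Δ = cancel-Tⁿ {H} x nz (divides E (≈-sym e))
  multiple-zero x {Δ = Δ} {E} (H≡TK K refl mK K0≢0 refl) _ bΔ e top =
    ≈-trans Δ≈cK (≈-trans (scale-cong (c≡0 x e top) ≈-refl) (scale-0 K))
    where
      K∣Δ = cancel-T-factor {K} x K0≢0 (divides E (≈-sym e))
      c = coeff (quotient K∣Δ) 0
      Δ≈cK : Δ ≈ scale c K
      Δ≈cK = low-multiple mK K∣Δ bΔ
      c≡0 : ∀ x → shift x Δ ≈ ((0# ∷ K) ⊛ E) → TopVanishes x E → c ≡ 0#
      -- x = 0: the constant term c·K(0) of Δ = T·K·E vanishes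
      c≡0 zero e _ = no-zero-divisors (coeff K 0) c K0≢0 (begin
        coeff K 0 * c           ≡⟨ *-comm _ c ⟩
        c * coeff K 0           ≡⟨ sym (coeff-scale c K 0) ⟩
        coeff (scale c K) 0     ≡⟨ sym (at Δ≈cK 0) ⟩
        coeff Δ 0               ≡⟨ at e 0 ⟩
        coeff ((0# ∷ K) ⊛ E) 0  ≡⟨ at (0∷-⊛ K E) 0 ⟩
        0#                      ∎)
        where open ≡-Reasoning
      -- x = x' + 1: K·(c·T^x') = T^x'·Δ = K·E, so c·T^x' = E
      c≡0 (suc x') e E-top = begin
        c                              ≡⟨ sym (monomial-leading x' c) ⟩
        coeff (monomial x' c) x'       ≡⟨ at (monic-cancelˡ mK KcT≈KE) x' ⟩
        coeff E x'                     ≡⟨ E-top ⟩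
        0#                             ∎
        where
          open ≡-Reasoning
          KcT≈KE : (K ⊛ monomial x' c) ≈ (K ⊛ E)
          KcT≈KE = ≈-trans (⊛-shift x' K [ c ])
                     (≈-trans (shift-cong x' (≈-trans (⊛-const c K) (≈-sym Δ≈cK)))
                       (tail-cong {0# ∷ shift x' Δ} {0# ∷ (K ⊛ E)} (≈-trans e (0∷-⊛ K E))))

  -- If T^x·G₁ = H₁·S₁ + H₁·t with G₁ coprime to H₁ and H₂ also annihilates t,
  -- then H₁ ∣ T^x·H₂: indeed H₂·T^x·G₁ = H₁·(H₂·S₁ + H₂·t) is divisible by
  -- H₁, so Gauss' lemma applies to G₁·T^x·H₂.
  divides-shifted-denominator : ∀ x {k H₁ H₂ G₁ S₁ t} → Coprime G₁ H₁ → Monic k H₁ →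
    Annihilates H₁ t → Annihilates H₂ t → shift x G₁ ≈ ((H₁ ⊛ S₁) ⊕ polyPart H₁ t) →
    H₁ ∣ shift x H₂
  divides-shifted-denominator x {k} {H₁} {H₂} {G₁} {S₁} {t} coprime m₁ a₁ a₂ e =
    gauss {k} {G₁} {H₁} {shift x H₂} coprime m₁ (∣-resp-≈ H₁∣H₂TG₁ H₂TG₁≈G₁TH₂)
    where
      -- H₂·(H₁·t) and H₁·(H₂·t) are both (H₁H₂)·t
      tails : (H₂ ⊛ polyPart H₁ t) ≈ (H₁ ⊛ polyPart H₂ t)
      tails = ≈-trans (polyPart-⊛ H₂ H₁ t a₁)
                (≈-trans (polyPart-congˡ t (⊛-comm H₂ H₁)) (≈-sym (polyPart-⊛ H₁ H₂ t a₂)))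
      H₁∣H₂TG₁ : H₁ ∣ (H₂ ⊛ shift x G₁)
      H₁∣H₂TG₁ = ∣-resp-≈ (∣-⊕ (∣-⊛ˡ H₂ (divides S₁ ≈-refl)) (divides (polyPart H₂ t) (≈-sym tails)))
                   (≈-trans (≈-sym (⊛-distribˡ H₂ (H₁ ⊛ S₁) (polyPart H₁ t))) (⊛-congʳ H₂ (≈-sym e)))
      H₂TG₁≈G₁TH₂ : (H₂ ⊛ shift x G₁) ≈ (G₁ ⊛ shift x H₂)
      H₂TG₁≈G₁TH₂ = ≈-trans (⊛-shift x H₂ G₁) (≈-trans (shift-cong x (⊛-comm H₂ G₁)) (≈-sym (⊛-shift x G₁ H₂)))

  firstDigit : ∀ {h x θ p} → GoodPair h x θ p → Carrier
  firstDigit {p = g , a} (_ , _ , _ , _ , s , _) = s 0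

  truncations-top : ∀ x s₁ s₂ → x ≡ 0 ⊎ s₁ 0 ≡ s₂ 0 →
                    TopVanishes x (truncation s₁ x ⊕ negate (truncation s₂ x))
  truncations-top zero      _  _  _         = tt
  truncations-top (suc x') s₁ s₂ (inj₁ ())
  truncations-top (suc x') s₁ s₂ (inj₂ s₀≡) =
    trans (coeff-minus (truncation s₁ (suc x')) (truncation s₂ (suc x')) x')
      (trans (cong₂ (λ u v → u + (- 1#) * v) (coeff-truncation s₁ x') (coeff-truncation s₂ x'))
        (trans (cong (λ v → s₁ 0 + (- 1#) * v) (sym s₀≡)) (minus-cancelʳ (s₁ 0))))

  good-pairs-equal : ∀ {h x θ} {p₁ p₂ : Vec Carrier h × Vec Carrier h}
    (gp₁ : GoodPair h x θ p₁) (gp₂ : GoodPair h x θ p₂) →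
    x ≡ 0 ⊎ firstDigit {p = p₁} gp₁ ≡ firstDigit {p = p₂} gp₂ → p₁ ≡ p₂
  good-pairs-equal {h} {x} {p₁ = g₁ , a₁} {g₂ , a₂}
    (sf₁ , ≢1₁ , _ , coprime₁ , s₁ , (pos₁ , neg₁) , θ≡₁)
    (sf₂ , ≢1₂ , _ , coprime₂ , s₂ , (pos₂ , neg₂) , θ≡₂) x≡0⊎s₀≡ =
    cong₂ _,_ (toList-injective g₁ g₂ G₁≈G₂) (monic-injective a₁ a₂ H₁≈H₂)
    where
      H₁ = monic a₁
      H₂ = monic a₂
      m₁ = monic-Monic a₁
      m₂ = monic-Monic a₂
      ann₁ = expansion-annihilates H₁ s₁ neg₁
      ann₂ = expansion-annihilates H₂ s₂ neg₂
      -- the fractional parts t₁, t₂ of T^x·G/H agree with θ in 2h places,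
      -- hence are equal, and both H₁ and H₂ annihilate t₁
      t₁≡t₂ : ∀ n → advance x s₁ n ≡ advance x s₂ n
      t₁≡t₂ = tails-equal (advance x s₁) (advance x s₂) m₁ m₂
                (annihilates-advance H₁ s₁ x ann₁) (annihilates-advance H₂ s₂ x ann₂)
                (λ k k<2h → let k<2*h = subst (k <_) (cong (h ℕ.+_) (sym (ℕP.+-identityʳ h))) k<2h
                            in trans (θ≡₁ k k<2*h) (sym (θ≡₂ k k<2*h)))
      t = advance x s₁
      annt₁ : Annihilates H₁ t
      annt₁ = annihilates-advance H₁ s₁ x ann₁
      annt₂ : Annihilates H₂ t
      annt₂ n = trans (residue-congʳ H₂ (λ i → t₁≡t₂ (i ℕ.+ n))) (annihilates-advance H₂ s₂ x ann₂ n)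
      E₁ : shift x (toList g₁) ≈ ((H₁ ⊛ truncation s₁ x) ⊕ polyPart H₁ t)
      E₁ = shifted-expansion H₁ (toList g₁) s₁ ann₁ (expansion-polyPart H₁ s₁ (toList g₁) pos₁) x
      E₂ : shift x (toList g₂) ≈ ((H₂ ⊛ truncation s₂ x) ⊕ polyPart H₂ t)
      E₂ = ≈-trans (shifted-expansion H₂ (toList g₂) s₂ ann₂ (expansion-polyPart H₂ s₂ (toList g₂) pos₂) x)
                   (⊕-cong (≈-refl {H₂ ⊛ truncation s₂ x}) (polyPart-congʳ H₂ (λ k → sym (t₁≡t₂ k))))
      -- H₁ ∣ T^x·H₂ and H₂ ∣ T^x·H₁, so H₁ = H₂
      shape₁ = squarefree-shape a₁ sf₁ ≢1₁
      H₁≈H₂ : H₁ ≈ H₂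
      H₁≈H₂ = denominators-equal shape₁ (squarefree-shape a₂ sf₂ ≢1₂) m₁ m₂
                (divides-shifted-denominator x coprime₁ m₁ annt₁ annt₂ E₁)
                (divides-shifted-denominator x coprime₂ m₂ annt₂ annt₁ E₂)
      -- then T^x·(G₁ − G₂) = H₁·(truncation s₁ x − truncation s₂ x), so G₁ = G₂
      E₂′ : shift x (toList g₂) ≈ ((H₁ ⊛ truncation s₂ x) ⊕ polyPart H₁ t)
      E₂′ = ≈-trans E₂ (⊕-cong (⊛-congˡ (truncation s₂ x) (≈-sym H₁≈H₂)) (polyPart-congˡ t (≈-sym H₁≈H₂)))
      G₁≈G₂ : toList g₁ ≈ toList g₂
      G₁≈G₂ = minus-zero (multiple-zero x shape₁ m₁
                (DegBelow-minus (toList-degree g₁) (toList-degree g₂))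
                (shifted-difference x {H₁} E₁ E₂′) (truncations-top x s₁ s₂ x≡0⊎s₀≡))

lemma3p2 : (q : ℕ) (F : FiniteField q) (h x : ℕ) (θ : FqT.U F) →
    ((L : List (Vec (FiniteField.Carrier F) h × Vec (FiniteField.Carrier F) h)) →
    Unique L → All (FqT.GoodPair F h x θ) L → length L ≤ q)
    × (x ≡ 0 →
    (L : List (Vec (FiniteField.Carrier F) h × Vec (FiniteField.Carrier F) h)) →
    Unique L → All (FqT.GoodPair F h x θ) L → length L ≤ 1)
lemma3p2 q F h x θ = at-most-q , at-most-one
  where
    open FiniteField F using (Carrier)
    open FqT F using (GoodPair)
    open Theory F using (firstDigit; good-pairs-equal; index; index-injective)

    Pair = Vec Carrier h × Vec Carrier h

    s₀ : ∀ {p} → GoodPair h x θ p → Carrier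
    s₀ {p} = firstDigit {p = p}

    at-most-q : (L : List Pair) → Unique L → All (GoodPair h x θ) L → length L ≤ q
    at-most-q L distinct goods =
      subst (_≤ q) (reduce-length {P = GoodPair h x θ} (λ {p} → s₀ {p}) goods)
        (unique-length-bound index index-injective (reduce {P = GoodPair h x θ} (λ {p} → s₀ {p}) goods)
          (reduce-unique {P = GoodPair h x θ} (λ {p} → s₀ {p})
            (λ {p₁} {p₂} gp₁ gp₂ same → good-pairs-equal {p₁ = p₁} {p₂} gp₁ gp₂ (inj₂ same))
            goods distinct))

    at-most-one : x ≡ 0 → (L : List Pair) → Unique L → All (GoodPair h x θ) L → length L ≤ 1
    at-most-one _   []             _                 _                 = z≤n
    at-most-one _   (_ ∷ [])       _                 _                 = s≤s z≤n
    at-most-one x≡0 (p₁ ∷ p₂ ∷ _) ((p₁≢p₂ ∷ _) ∷ _) (gp₁ ∷ gp₂ ∷ _) =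
      ⊥-elim (p₁≢p₂ (good-pairs-equal {p₁ = p₁} {p₂} gp₁ gp₂ (inj₁ x≡0)))
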